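{- Suppose $\mu \prec \rho \succ \nu$ are $d$-partitions. Then there exists a unique $d$-partition $\kappa$ and a unique nonnegative integer $m$ such that the cell with entry $m$ and corner partitions $\kappa$ (bottom-left), $\mu$ (top-left), $\nu$ (bottom-right), $\rho$ (top-right) satisfies the $d$-RSK local rule.
   Context: A partition is a finite weakly decreasing sequence of positive integers $\lambda=(\lambda_1,\ldots,\lambda_m)$; its length $\ell(\lambda)$ is the number of parts, and one sets $\lambda_i=0$ for $i>\ell(\lambda)$. A $d$-partition is a partition of length at most $d$. For partitions $\alpha,\beta$, write $\alpha \prec \beta$ (equivalently $\beta\succ\alpha$, "$\alpha$ interlaces $\beta$") if $\beta_1 \geq \alpha_1 \geq \beta_2 \geq \alpha_2 \geq \beta_3 \geq \cdots$. A cell is a unit square carrying a nonnegative integer entry $m$ and four partitions at its corners: $\kappa$ at the bottom-left, $\mu$ at the top-left, $\nu$ at the bottom-right, $\rho$ at the top-right. The cell satisfies the $d$-RSK local rule if: $\mu \succ \kappa \prec \nu$ and $\mu \prec \rho \succ \nu$; all four of $\kappa,\mu,\nu,\rho$ are $d$-partitions; $m=0$ or $\kappa_d=0$; and $\rho_1+\kappa_d = m+\min(\mu_d,\nu_d)+\max(\mu_1,\nu_1)$ and $\rho_i+\kappa_{i-1} = \min(\mu_{i-1},\nu_{i-1})+\max(\mu_i,\nu_i)$ for $2\le i\le d$. -}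

module Defs where

open import Data.Nat using (ℕ; zero; suc; _+_; _∸_; _≤_; _<_; _≥_; _⊓_; _⊔_)
open import Data.List using (List; []; _∷_; length)
open import Data.List.Relation.Unary.All using (All)
open import Data.List.Relation.Unary.Linked using (Linked)
open import Data.Product using (_×_)
open import Relation.Binary.PropositionalEquality using (_≡_)
open import Data.Sum using (_⊎_)

IsPartition : List ℕ → Set
IsPartition l = All (λ x → 1 ≤ x) l × Linked _≥_ l

IsDPartition : ℕ → List ℕ → Set
IsDPartition d l = IsPartition l × length l ≤ d

-- 0-indexed part:  part λ i  is  λ_{i+1}  in the paper's 1-indexed notation,
-- and is 0 beyond the length.
part : List ℕ → ℕ → ℕ
part []       _       = 0
part (x ∷ _)  zero    = x
part (_ ∷ xs) (suc i) = part xs i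

_≺_ : List ℕ → List ℕ → Set
α ≺ β = ∀ i → part α i ≤ part β i × part β (suc i) ≤ part α i

infix 4 _≺_

-- The d-RSK local rule for the cell with entry m and corners
-- κ (bottom-left), μ (top-left), ν (bottom-right), ρ (top-right).
-- (κ_d is  part κ (d ∸ 1), μ_1 is part μ 0, etc.)
LocalRule : ℕ → (m : ℕ) → (κ μ ν ρ : List ℕ) → Set
LocalRule d m κ μ ν ρ =
  (κ ≺ μ) × (κ ≺ ν) × (μ ≺ ρ) × (ν ≺ ρ)
  × IsDPartition d κ × IsDPartition d μ × IsDPartition d ν × IsDPartition d ρ
  × (m ≡ 0 ⊎ part κ (d ∸ 1) ≡ 0)
  × (part ρ 0 + part κ (d ∸ 1)
       ≡ m + (part μ (d ∸ 1) ⊓ part ν (d ∸ 1)) + (part μ 0 ⊔ part ν 0))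
  -- for 2 ≤ i ≤ d, with i = j + 2:  ρ_i + κ_{i-1} = min(μ_{i-1},ν_{i-1}) + max(μ_i,ν_i)
  × (∀ j → suc j < d →
       part ρ (suc j) + part κ j
         ≡ (part μ j ⊓ part ν j) + (part μ (suc j) ⊔ part ν (suc j)))

module Submission where

-- For i < d the equation of the local rule at row i+1 is linear in κ_i alone and
-- forces κ_i = min(μ_i,ν_i) + max(μ_{i+1},ν_{i+1}) − ρ_{i+1}; the first equation,
-- together with m = 0 or κ_d = 0, forces m and κ_d to be the positive and negative
-- parts of ρ_1 − (min(μ_d,ν_d) + max(μ_1,ν_1)). Interlacing μ ≺ ρ ≻ ν places every
-- such κ_i between max(μ_{i+1},ν_{i+1}) and min(μ_i,ν_i), so κ is a d-partition
-- interlacing both μ and ν.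

open import Defs
open import Data.Nat using (ℕ; zero; suc; _+_; _∸_; _≤_; _<_; _≥_; _⊓_; _⊔_; z≤n; s≤s; _≟_; _<?_)
open import Data.Nat.Properties
open import Data.List using (List; []; _∷_; length)
open import Data.List.Relation.Unary.All using (All; []; _∷_)
open import Data.List.Relation.Unary.Linked using (Linked; []; [-]; _∷_)
open import Data.Product using (Σ; _×_; _,_; proj₁; proj₂)
open import Data.Sum using (_⊎_; inj₁; inj₂)
open import Function using (_∘_)
open import Relation.Nullary using (yes; no; contradiction)
open import Relation.Binary.PropositionalEquality

m+n≡o⇒n≡o∸m : ∀ {m n o} → m + n ≡ o → n ≡ o ∸ m
m+n≡o⇒n≡o∸m {m} {n} eq = trans (sym (m+n∸m≡n m n)) (cong (_∸ m) eq)

m+n∸o≤m : ∀ m {n o} → n ≤ o → m + n ∸ o ≤ m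
m+n∸o≤m m {n} {o} n≤o = begin
  m + n ∸ o  ≤⟨ ∸-monoˡ-≤ o (+-monoʳ-≤ m n≤o) ⟩
  m + o ∸ o  ≡⟨ m+n∸n≡m m o ⟩
  m          ∎
  where open ≤-Reasoning

n≤m+n∸o : ∀ {m} n {o} → o ≤ m → n ≤ m + n ∸ o
n≤m+n∸o {m} n {o} o≤m = begin
  n              ≤⟨ m≤n+m n (m ∸ o) ⟩
  m ∸ o + n      ≡⟨ sym (+-∸-comm n o≤m) ⟩
  m + n ∸ o      ∎
  where open ≤-Reasoning

m+[n∸m]≡[m∸n]+n : ∀ m n → m + (n ∸ m) ≡ (m ∸ n) + n
m+[n∸m]≡[m∸n]+n m n with ≤-total m n
... | inj₁ m≤n rewrite m≤n⇒m∸n≡0 m≤n = m+[n∸m]≡n m≤n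
... | inj₂ n≤m rewrite m≤n⇒m∸n≡0 n≤m = trans (+-identityʳ m) (sym (m∸n+n≡m n≤m))

m∸n≡0⊎n∸m≡0 : ∀ m n → m ∸ n ≡ 0 ⊎ n ∸ m ≡ 0
m∸n≡0⊎n∸m≡0 m n with ≤-total m n
... | inj₁ m≤n = inj₁ (m≤n⇒m∸n≡0 m≤n)
... | inj₂ n≤m = inj₂ (m≤n⇒m∸n≡0 n≤m)

m+k≡n+o⇒k≡o∸m×n≡m∸o : ∀ {m k n o} → m + k ≡ n + o → n ≡ 0 ⊎ k ≡ 0
                    → k ≡ o ∸ m × n ≡ m ∸ o
m+k≡n+o⇒k≡o∸m×n≡m∸o {m} {k} eq (inj₁ refl) =
  m+n≡o⇒n≡o∸m eq , sym (m≤n⇒m∸n≡0 (subst (m ≤_) eq (m≤m+n m k)))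
m+k≡n+o⇒k≡o∸m×n≡m∸o {m} {n = n} {o} eq (inj₂ refl) =
  sym (m≤n⇒m∸n≡0 (subst (o ≤_) (sym m≡n+o) (m≤n+m o n))) ,
  sym (trans (cong (_∸ o) m≡n+o) (m+n∸n≡m n o))
  where
  m≡n+o : m ≡ n + o
  m≡n+o = trans (sym (+-identityʳ m)) eq

_[_]≔_ : ∀ {a} {A : Set a} → (ℕ → A) → ℕ → A → ℕ → A
(f [ zero  ]≔ x) zero    = x
(f [ zero  ]≔ x) (suc j) = f (suc j)
(f [ suc i ]≔ x) zero    = f zero
(f [ suc i ]≔ x) (suc j) = ((f ∘ suc) [ i ]≔ x) j

[]≔-updates : ∀ {a} {A : Set a} (f : ℕ → A) i x → (f [ i ]≔ x) i ≡ x
[]≔-updates f zero    x = refl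
[]≔-updates f (suc i) x = []≔-updates (f ∘ suc) i x

[]≔-minimal : ∀ {a} {A : Set a} (f : ℕ → A) {i j} x → j ≢ i → (f [ i ]≔ x) j ≡ f j
[]≔-minimal f {zero}  {zero}  x j≢i = contradiction refl j≢i
[]≔-minimal f {zero}  {suc j} x j≢i = refl
[]≔-minimal f {suc i} {zero}  x j≢i = refl
[]≔-minimal f {suc i} {suc j} x j≢i = []≔-minimal (f ∘ suc) x (j≢i ∘ cong suc)

part-beyond : ∀ (l : List ℕ) {i} → length l ≤ i → part l i ≡ 0
part-beyond []                 _         = refl
part-beyond (_ ∷ l) {suc i}    (s≤s l≤i) = part-beyond l l≤i

part-injective : ∀ {a b : List ℕ} → All (1 ≤_) a → All (1 ≤_) b
               → (∀ i → part a i ≡ part b i) → a ≡ b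
part-injective {[]}    {[]}    _          _          _  = refl
part-injective {[]}    {_ ∷ _} _          (1≤y ∷ _)  eq = contradiction (sym (eq 0)) (m<n⇒n≢0 1≤y)
part-injective {_ ∷ _} {[]}    (1≤x ∷ _)  _          eq = contradiction (eq 0) (m<n⇒n≢0 1≤x)
part-injective {_ ∷ _} {_ ∷ _} (_ ∷ pos₁) (_ ∷ pos₂) eq =
  cong₂ _∷_ (eq 0) (part-injective pos₁ pos₂ (eq ∘ suc))

dPartition-≡ : ∀ {d a b} → IsDPartition d a → IsDPartition d b
             → (∀ i → i < d → part a i ≡ part b i) → a ≡ b
dPartition-≡ {d} {a} {b} ((pos₁ , _) , len₁) ((pos₂ , _) , len₂) eq =
  part-injective pos₁ pos₂ agree
  where
  agree : ∀ i → part a i ≡ part b i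
  agree i with i <? d
  ... | yes i<d = eq i i<d
  ... | no  i≮d = trans (part-beyond a (≤-trans len₁ (≮⇒≥ i≮d)))
                        (sym (part-beyond b (≤-trans len₂ (≮⇒≥ i≮d))))

linked-≥-from-part : ∀ (l : List ℕ) → (∀ i → part l (suc i) ≤ part l i) → Linked _≥_ l
linked-≥-from-part []          _    = []
linked-≥-from-part (_ ∷ [])    _    = [-]
linked-≥-from-part (_ ∷ y ∷ l) desc = desc 0 ∷ linked-≥-from-part (y ∷ l) (desc ∘ suc)

fromParts : ℕ → (ℕ → ℕ) → List ℕ
fromParts zero    f = []
fromParts (suc n) f with f 0
... | zero  = []
... | suc k = suc k ∷ fromParts n (f ∘ suc)

fromParts-length : ∀ n f → length (fromParts n f) ≤ n
fromParts-length zero    f = z≤n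
fromParts-length (suc n) f with f 0
... | zero  = z≤n
... | suc k = s≤s (fromParts-length n (f ∘ suc))

fromParts-positive : ∀ n f → All (1 ≤_) (fromParts n f)
fromParts-positive zero    f = []
fromParts-positive (suc n) f with f 0
... | zero  = []
... | suc k = s≤s z≤n ∷ fromParts-positive n (f ∘ suc)

part-fromParts : ∀ n f → (∀ i → f (suc i) ≤ f i) → (∀ i → n ≤ i → f i ≡ 0)
               → ∀ i → part (fromParts n f) i ≡ f i
part-fromParts zero    f desc beyond i = sym (beyond i z≤n)
part-fromParts (suc n) f desc beyond i with f 0 in f0≡
... | zero  = sym (n≤0⇒n≡0 (subst (f i ≤_) f0≡ (below-head i)))
  where
  below-head : ∀ i → f i ≤ f 0
  below-head zero    = ≤-refl
  below-head (suc i) = ≤-trans (desc i) (below-head i)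
part-fromParts (suc n) f desc beyond zero    | suc k = sym f0≡
part-fromParts (suc n) f desc beyond (suc i) | suc k =
  part-fromParts n (f ∘ suc) (desc ∘ suc) (λ j n≤j → beyond (suc j) (s≤s n≤j)) i

fromParts-isDPartition : ∀ n f → (∀ i → f (suc i) ≤ f i) → (∀ i → n ≤ i → f i ≡ 0)
                       → IsDPartition n (fromParts n f)
fromParts-isDPartition n f desc beyond =
  (fromParts-positive n f , linked-≥-from-part (fromParts n f) desc′) , fromParts-length n f
  where
  parts = part-fromParts n f desc beyond
  desc′ : ∀ i → part (fromParts n f) (suc i) ≤ part (fromParts n f) i
  desc′ i = subst₂ _≤_ (sym (parts (suc i))) (sym (parts i)) (desc i)

⊔≤≤⊓⇒≺×≺ : ∀ {κ μ ν} → (∀ i → part μ (suc i) ⊔ part ν (suc i) ≤ part κ i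
                                × part κ i ≤ part μ i ⊓ part ν i)
         → κ ≺ μ × κ ≺ ν
⊔≤≤⊓⇒≺×≺ bounds =
  (λ i → ≤-trans (upper i) (m⊓n≤m _ _) , ≤-trans (m≤m⊔n _ _) (lower i)) ,
  (λ i → ≤-trans (upper i) (m⊓n≤n _ _) , ≤-trans (m≤n⊔m _ _) (lower i))
  where
  lower = proj₁ ∘ bounds
  upper = proj₂ ∘ bounds

-- d = suc e: part _ e is the paper's λ_d and part _ 0 its λ_1.
module LocalRuleSolution (e : ℕ) (μ ν ρ : List ℕ)
  (dμ : IsDPartition (suc e) μ) (dν : IsDPartition (suc e) ν) (dρ : IsDPartition (suc e) ρ)
  (μ≺ρ : μ ≺ ρ) (ν≺ρ : ν ≺ ρ) where

  min max : ℕ → ℕ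
  min i = part μ i ⊓ part ν i
  max i = part μ i ⊔ part ν i

  max≤ρ : ∀ i → max i ≤ part ρ i
  max≤ρ i = ⊔-lub (proj₁ (μ≺ρ i)) (proj₁ (ν≺ρ i))

  ρ≤min : ∀ i → part ρ (suc i) ≤ min i
  ρ≤min i = ⊓-glb (proj₂ (μ≺ρ i)) (proj₂ (ν≺ρ i))

  max-beyond : ∀ i → suc e ≤ i → max i ≡ 0
  max-beyond i d≤i
    rewrite part-beyond μ (≤-trans (proj₂ dμ) d≤i) | part-beyond ν (≤-trans (proj₂ dν) d≤i) = refl

  -- The first equation of the rule reads  ρ_1 + κ_d ≡ m + total.
  total : ℕ
  total = min e + max 0

  m : ℕ
  m = part ρ 0 ∸ total

  κ-inner : ℕ → ℕ
  κ-inner j = min j + max (suc j) ∸ part ρ (suc j)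

  κ-last : ℕ
  κ-last = total ∸ part ρ 0

  κ-fun : ℕ → ℕ
  κ-fun = κ-inner [ e ]≔ κ-last

  κ-fun-bounds : ∀ i → max (suc i) ≤ κ-fun i × κ-fun i ≤ min i
  κ-fun-bounds i with i ≟ e
  ... | yes refl rewrite []≔-updates κ-inner e κ-last =
    ≤-trans (≤-reflexive (max-beyond (suc e) ≤-refl)) z≤n , m+n∸o≤m (min e) (max≤ρ 0)
  ... | no i≢e rewrite []≔-minimal κ-inner κ-last i≢e =
    n≤m+n∸o (max (suc i)) (ρ≤min i) , m+n∸o≤m (min i) (max≤ρ (suc i))

  κ-fun-antitone : ∀ i → κ-fun (suc i) ≤ κ-fun i
  κ-fun-antitone i = begin
    κ-fun (suc i)  ≤⟨ proj₂ (κ-fun-bounds (suc i)) ⟩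
    min (suc i)    ≤⟨ m⊓n≤m⊔n (part μ (suc i)) (part ν (suc i)) ⟩
    max (suc i)    ≤⟨ proj₁ (κ-fun-bounds i) ⟩
    κ-fun i        ∎
    where open ≤-Reasoning

  κ-fun-beyond : ∀ i → suc e ≤ i → κ-fun i ≡ 0
  κ-fun-beyond i d≤i = n≤0⇒n≡0 (begin
    κ-fun i  ≤⟨ proj₂ (κ-fun-bounds i) ⟩
    min i    ≤⟨ m⊓n≤m⊔n (part μ i) (part ν i) ⟩
    max i    ≡⟨ max-beyond i d≤i ⟩
    0        ∎)
    where open ≤-Reasoning

  κ : List ℕ
  κ = fromParts (suc e) κ-fun

  part-κ : ∀ i → part κ i ≡ κ-fun i
  part-κ = part-fromParts (suc e) κ-fun κ-fun-antitone κ-fun-beyond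

  κ-isDPartition : IsDPartition (suc e) κ
  κ-isDPartition = fromParts-isDPartition (suc e) κ-fun κ-fun-antitone κ-fun-beyond

  part-κ-< : ∀ {j} → j < e → part κ j ≡ κ-inner j
  part-κ-< {j} j<e = trans (part-κ j) ([]≔-minimal κ-inner κ-last (<⇒≢ j<e))

  part-κ-last : part κ e ≡ κ-last
  part-κ-last = trans (part-κ e) ([]≔-updates κ-inner e κ-last)

  κ-localRule : LocalRule (suc e) m κ μ ν ρ
  κ-localRule =
    κ≺μ , κ≺ν , μ≺ρ , ν≺ρ , κ-isDPartition , dμ , dν , dρ ,
    complementary , first-equation , later-equations
    where
    κ≺μ×κ≺ν : κ ≺ μ × κ ≺ ν
    κ≺μ×κ≺ν = ⊔≤≤⊓⇒≺×≺ {κ} {μ} {ν} (λ i → subst (λ k → max (suc i) ≤ k × k ≤ min i)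
                                      (sym (part-κ i)) (κ-fun-bounds i))
    κ≺μ = proj₁ κ≺μ×κ≺ν
    κ≺ν = proj₂ κ≺μ×κ≺ν

    complementary : m ≡ 0 ⊎ part κ e ≡ 0
    complementary rewrite part-κ-last = m∸n≡0⊎n∸m≡0 (part ρ 0) total

    first-equation : part ρ 0 + part κ e ≡ m + min e + max 0
    first-equation rewrite part-κ-last | +-assoc m (min e) (max 0) =
      m+[n∸m]≡[m∸n]+n (part ρ 0) total

    later-equations : ∀ j → suc j < suc e → part ρ (suc j) + part κ j ≡ min j + max (suc j)
    later-equations j (s≤s j<e) rewrite part-κ-< j<e =
      m+[n∸m]≡n (≤-trans (ρ≤min j) (m≤m+n (min j) (max (suc j))))

  localRule-unique : ∀ κ′ m′ → LocalRule (suc e) m′ κ′ μ ν ρ → κ′ ≡ κ × m′ ≡ m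
  localRule-unique κ′ m′ (_ , _ , _ , _ , dκ′ , _ , _ , _ , complementary , first-eq , later-eqs) =
    dPartition-≡ dκ′ κ-isDPartition (λ i i<d → agree i (m<1+n⇒m<n∨m≡n i<d)) , proj₂ last
    where
    last : part κ′ e ≡ κ-last × m′ ≡ part ρ 0 ∸ total
    last = m+k≡n+o⇒k≡o∸m×n≡m∸o (trans first-eq (+-assoc m′ (min e) (max 0))) complementary

    agree : ∀ i → i < e ⊎ i ≡ e → part κ′ i ≡ part κ i
    agree i (inj₁ i<e) = trans (m+n≡o⇒n≡o∸m (later-eqs i (s≤s i<e))) (sym (part-κ-< i<e))
    agree i (inj₂ refl) = trans (proj₁ last) (sym part-κ-last)

lemma6p2 : (d : ℕ) → 1 ≤ d → (μ ν ρ : List ℕ)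
    → IsDPartition d μ → IsDPartition d ν → IsDPartition d ρ
    → μ ≺ ρ → ν ≺ ρ
    → Σ (List ℕ) (λ κ → Σ ℕ (λ m →
        IsDPartition d κ × LocalRule d m κ μ ν ρ
        × ((κ′ : List ℕ) (m′ : ℕ) → IsDPartition d κ′ → LocalRule d m′ κ′ μ ν ρ
            → κ′ ≡ κ × m′ ≡ m)))
lemma6p2 (suc e) (s≤s z≤n) μ ν ρ dμ dν dρ μ≺ρ ν≺ρ =
  κ , m , κ-isDPartition , κ-localRule , λ κ′ m′ _ → localRule-unique κ′ m′
  where open LocalRuleSolution e μ ν ρ dμ dν dρ μ≺ρ ν≺ρ
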